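{- Let $\Phi=(V,\mathscr{C})$ be a hypergraph with $V=[n]$, let $L\in\mathbb{N}$, $T=n(L+1)$, $\ell:=\lfloor\frac{L+1}{2}\rfloor$, and $C\in\mathscr{C}$. Let $\tau$ be a labelled directed path with vertices $u_1,\dots,u_\ell$, edges $(u_i,u_{i+1})$ for $i\in[\ell-1]$ and labels $\mathcal{L}(u_1)=C$ and $\mathcal{L}(u_{i+1})\in\Gamma^+_{\Phi^2}(\mathcal{L}(u_i))$ for each $i<\ell$. Then the number of tuples $(e_1,\dots,e_\ell)\in\mathcal{P}^2_{C,\ell}$ with $C(e_i)=\mathcal{L}(u_i)$ for all $i\in[\ell]$ is at most \[ 2^{\ell-1}\cdot\prod_{i=1}^{\ell}\lvert\mathcal{L}(u_i)\rvert. \]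
   Context: $\Phi=(V,\mathscr{C})$ has vertex set $V=[n]$ and hyperedges $\mathscr{C}$ (nonempty subsets of $V$). $\Gamma^+_{\Phi^2}(C)$ is the set of $C'\in\mathscr{C}$ with $C\cap C'\neq\emptyset$ or such that some $C^*\in\mathscr{C}$ satisfies $C\cap C^*\neq\emptyset\neq C^*\cap C'$. Scan sequence $v_i:=(i\bmod n)+1$. $\mathrm{UpdTime}(v,t):=\max\{t^*\le t:v_{t^*}=v\}$. For $C\in\mathscr{C}$ and integer $t$, $e_{C,t}:=\{\mathrm{UpdTime}(v,t):v\in C\}$ with label $C(e_{C,t}):=C$. The witness graph $H_T$ is the directed graph on $V_T:=\{e_{C,t}:t\in[T],C\in\mathscr{C},v_t\in C\}$ (vertices regarded as pairs $(C,t)$) with an edge $e_{C,t}\to e_{C',t'}$ iff $t'<t$ and $e_{C,t}\cap e_{C',t'}\neq\emptyset$. An induced path of length $L$ is a sequence $(e_1,\dots,e_L)$ of distinct vertices with $e_i\to e_{i+1}$ an edge for each $i<L$ and no other edges of $H_T$ among them. $\mathcal{P}_{C,L}$ is the set of induced paths $(e_1,\dots,e_L)$ in $H_T$ with $e_1\cap(T-n,T]\neq\emptyset$ and $C(e_1)=C$, and $\mathcal{P}^2_{C,\ell}:=\{(e_1,e_3,\dots,e_{2\lfloor\frac{L-1}{2}\rfloor+1}):(e_1,\dots,e_L)\in\mathcal{P}_{C,L}\}$. -}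

module Defs where

open import Data.Nat as ℕ using (ℕ; zero; suc; NonZero; ⌊_/2⌋)
open import Data.Integer as ℤ using (ℤ; +_; _≤_; _<_; _-_)
open import Data.Integer.DivMod using (_%ℕ_; n%ℕd<d)
open import Data.Fin using (Fin; fromℕ<)
open import Data.Vec using (Vec; lookup)
open import Data.Fin.Subset using (Subset; _∈_; _∩_; Nonempty)
open import Data.Product using (Σ; ∃; _×_; _,_)
open import Data.Sum using (_⊎_)
open import Relation.Binary.PropositionalEquality using (_≡_; _≢_)

-- Vertices of [n] = {1,…,n} are represented by Fin n, where the element k : Fin n
-- stands for the vertex k+1.  A hyperedge is a Subset n; the hyperedge set 𝒞 is a
-- predicate on Subset n.

Meets : ∀ {n} → Subset n → Subset n → Set
Meets A B = Nonempty (A ∩ B)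

Γ⁺² : ∀ {n} → (Subset n → Set) → Subset n → Subset n → Set
Γ⁺² 𝒞 C C′ = 𝒞 C′ × (Meets C C′ ⊎ Σ _ (λ C* → 𝒞 C* × Meets C C* × Meets C* C′))

-- scan sequence v_i = (i mod n) + 1, i.e. the Fin-index (i mod n)
scan : (n : ℕ) .{{_ : NonZero n}} → ℤ → Fin n
scan n i = fromℕ< (n%ℕd<d i n)

module _ (n : ℕ) .{{_ : NonZero n}} where

  IsUpdTime : Fin n → ℤ → ℤ → Set
  IsUpdTime v t s = s ≤ t × scan n s ≡ v × (∀ t* → t* ≤ t → scan n t* ≡ v → t* ≤ s)

  InE : Subset n → ℤ → ℤ → Set
  InE C t s = ∃ λ v → v ∈ C × IsUpdTime v t s

  Vtx : Set
  Vtx = Subset n × ℤ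

  label : Vtx → Subset n
  label (C , t) = C

  InVT : (Subset n → Set) → ℤ → Vtx → Set
  InVT 𝒞 T (C , t) = 𝒞 C × (+ 1 ≤ t × t ≤ T) × scan n t ∈ C

  Edge : Vtx → Vtx → Set
  Edge (C , t) (C′ , t′) = t′ < t × ∃ λ s → InE C t s × InE C′ t′ s

  -- p 0, …, p (L-1) is an induced path of length L in H_T (0-indexed: e_{i+1} = p i)
  IsInducedPath : (Subset n → Set) → ℤ → (L : ℕ) → (ℕ → Vtx) → Set
  IsInducedPath 𝒞 T L p =
    (∀ i → i ℕ.< L → InVT 𝒞 T (p i)) ×
    (∀ i j → i ℕ.< L → j ℕ.< L → i ≢ j → p i ≢ p j) ×
    (∀ i → suc i ℕ.< L → Edge (p i) (p (suc i))) ×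
    (∀ i j → i ℕ.< L → j ℕ.< L → Edge (p i) (p j) → j ≡ suc i)

  InP : (Subset n → Set) → ℤ → Subset n → (L : ℕ) → (ℕ → Vtx) → Set
  InP 𝒞 T C L p =
    IsInducedPath 𝒞 T L p ×
    label (p 0) ≡ C ×
    (∃ λ s → InE (label (p 0)) (Data.Product.proj₂ (p 0)) s × (T - + n) < s × s ≤ T)

  -- x ∈ 𝒫²_{C,ℓ}, ℓ = ⌊(L+1)/2⌋: x = (e_1, e_3, …), i.e. x j = p (2j) (0-indexed)
  InP² : (Subset n → Set) → ℤ → Subset n → (L : ℕ) → Vec Vtx ⌊ suc L /2⌋ → Set
  InP² 𝒞 T C L x = ∃ λ p → InP 𝒞 T C L p × (∀ j → lookup x j ≡ p (2 ℕ.* Data.Fin.toℕ j))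

{-# OPTIONS --safe #-}
module Submission where

open import Data.Nat using (ℕ; NonZero)
open import Data.Integer using (ℤ)
open import Data.Fin.Subset using (Subset)
open import Defs

-- Since the labels are prescribed by 𝓛, a tuple (e₁, e₃, …) is determined by the times
-- t₁ > t₃ > ⋯ of its vertices.  An edge of H_T goes back in time by less than n, and t₁ lies
-- in (T − n, T]; hence t_{2j+1} lies among the 2n times up to t_{2j−1}.  Among n consecutive
-- times the scan vertex determines the time, so t_{2j+1} is determined by t_{2j−1}, by its
-- scan vertex, which lies in its label, and by one bit telling in which half of the window it
-- lies (t₁ needs no bit).  These digit strings are distinct for distinct tuples and range over
-- a set of size |𝓛 0| · ∏_{j ≥ 1} 2 |𝓛 j|.

module Lists where

  open import Data.Nat using (zero; suc; _+_; _*_; _^_; _≤_; z≤n; s≤s)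
  open import Data.Nat.ListAction using (product)
  open import Data.Nat.Tactic.RingSolver using (solve-∀)
  open import Data.Bool using (true; false)
  open import Data.Fin as Fin using (Fin)
  open import Data.Fin.Subset as Subset using (∣_∣)
  open import Data.Vec as Vec using (Vec; []; _∷_; here; there)
  open import Data.List
    using (List; []; _∷_; [_]; _++_; length; map; foldr; applyUpTo; cartesianProductWith)
  open import Data.List.Properties using (length-++; length-map)
  open import Data.List.Membership.Propositional using (_∈_)
  open import Data.List.Membership.Propositional.Properties
    using (∈-∃++; ∈-map⁺; ∈-cartesianProductWith⁺)
  open import Data.List.Relation.Unary.Any using (here; there)
  open import Data.List.Relation.Unary.All as All using (All; []; _∷_)
  import Data.List.Relation.Unary.All.Properties as Allₚ
  open import Data.List.Relation.Unary.AllPairs using ([]; _∷_)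
  open import Data.List.Relation.Unary.Unique.Propositional using (Unique)
  open import Data.List.Relation.Binary.Pointwise using (Pointwise; []; _∷_)
  open import Data.Product using (_,_)
  open import Data.Empty using (⊥-elim)
  open import Function using (_∘′_)
  open import Relation.Binary.PropositionalEquality
    using (_≡_; _≢_; refl; sym; trans; cong; cong₂; subst; module ≡-Reasoning)

  module _ {A : Set} where

    length-++-∷ : ∀ (us vs : List A) x → length (us ++ x ∷ vs) ≡ suc (length (us ++ vs))
    length-++-∷ []       vs x = refl
    length-++-∷ (u ∷ us) vs x = cong suc (length-++-∷ us vs x)

    ∈-++-∷⁻ : ∀ {x y : A} us vs → y ∈ us ++ x ∷ vs → x ≢ y → y ∈ us ++ vs
    ∈-++-∷⁻ []       vs (here y≡x) x≢y = ⊥-elim (x≢y (sym y≡x))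
    ∈-++-∷⁻ []       vs (there y∈) x≢y = y∈
    ∈-++-∷⁻ (u ∷ us) vs (here y≡u) x≢y = here y≡u
    ∈-++-∷⁻ (u ∷ us) vs (there y∈) x≢y = there (∈-++-∷⁻ us vs y∈ x≢y)

    Unique⇒length≤ : ∀ {xs ys : List A} → Unique xs → All (_∈ ys) xs → length xs ≤ length ys
    Unique⇒length≤ [] [] = z≤n
    Unique⇒length≤ {x ∷ xs} (x∉xs ∷ xs!) (x∈ys ∷ xs⊆ys) with us , vs , refl ← ∈-∃++ x∈ys =
      subst (suc (length xs) ≤_) (sym (length-++-∷ us vs x))
        (s≤s (Unique⇒length≤ xs! (All.zipWith (λ (x≢y , y∈) → ∈-++-∷⁻ us vs y∈ x≢y)
                                               (x∉xs , xs⊆ys))))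

    choices : List (List A) → List (List A)
    choices = foldr (cartesianProductWith _∷_) [ [] ]

    ∈-choices : ∀ {as cs} → Pointwise _∈_ as cs → as ∈ choices cs
    ∈-choices []            = here refl
    ∈-choices (a∈c ∷ as∈cs) = ∈-cartesianProductWith⁺ _∷_ a∈c (∈-choices as∈cs)

  module _ {A B : Set} {P : A → Set} {g : A → B}
           (g-injectiveOn : ∀ {x y} → P x → P y → g x ≡ g y → x ≡ y) where

    Unique-map⁺-injectiveOn : ∀ {xs} → All P xs → Unique xs → Unique (map g xs)
    Unique-map⁺-injectiveOn []         []           = []
    Unique-map⁺-injectiveOn (px ∷ pxs) (x∉xs ∷ xs!) =
      Allₚ.map⁺ (All.zipWith (λ (py , x≢y) → x≢y ∘′ g-injectiveOn px py) (pxs , x∉xs))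
        ∷ Unique-map⁺-injectiveOn pxs xs!

  length-cartesianProductWith : ∀ {A B C : Set} (f : A → B → C) xs ys →
                                length (cartesianProductWith f xs ys) ≡ length xs * length ys
  length-cartesianProductWith f []       ys = refl
  length-cartesianProductWith f (x ∷ xs) ys = begin
      length (map (f x) ys ++ cartesianProductWith f xs ys)
    ≡⟨ length-++ (map (f x) ys) ⟩
      length (map (f x) ys) + length (cartesianProductWith f xs ys)
    ≡⟨ cong₂ _+_ (length-map (f x) ys) (length-cartesianProductWith f xs ys) ⟩
      length ys + length xs * length ys
    ∎
    where open ≡-Reasoning

  length-choices : ∀ {A : Set} (cs : List (List A)) →
                   length (choices cs) ≡ product (map length cs)
  length-choices []       = refl
  length-choices (c ∷ cs) =
    trans (length-cartesianProductWith _∷_ c (choices cs)) (cong (length c *_) (length-choices cs))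

  product-applyUpTo-*ʳ : ∀ (a b : ℕ → ℕ) c k → (∀ j → a j ≡ b j * c) →
                         product (applyUpTo a k) ≡ c ^ k * product (applyUpTo b k)
  product-applyUpTo-*ʳ a b c zero    a≡bc = refl
  product-applyUpTo-*ʳ a b c (suc k) a≡bc = begin
      a 0 * product (applyUpTo (λ j → a (suc j)) k)
    ≡⟨ cong₂ _*_ (a≡bc 0) (product-applyUpTo-*ʳ _ _ c k (λ j → a≡bc (suc j))) ⟩
      b 0 * c * (c ^ k * product (applyUpTo (λ j → b (suc j)) k))
    ≡⟨ rearrange (b 0) c (c ^ k) _ ⟩
      c * c ^ k * (b 0 * product (applyUpTo (λ j → b (suc j)) k))
    ∎
    where
    open ≡-Reasoning
    rearrange : ∀ x y z w → x * y * (z * w) ≡ y * z * (x * w)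
    rearrange = solve-∀

  toList≗applyUpTo : ∀ {A : Set} {m} (xs : Vec A m) (f : ℕ → A) →
                     (∀ j → Vec.lookup xs j ≡ f (Fin.toℕ j)) → Vec.toList xs ≡ applyUpTo f m
  toList≗applyUpTo []       f _       = refl
  toList≗applyUpTo (x ∷ xs) f lookup≡ =
    cong₂ _∷_ (lookup≡ Fin.zero)
      (toList≗applyUpTo xs (λ j → f (suc j)) (λ j → lookup≡ (Fin.suc j)))

  elements : ∀ {m} → Subset m → List (Fin m)
  elements []          = []
  elements (true  ∷ p) = Fin.zero ∷ map Fin.suc (elements p)
  elements (false ∷ p) = map Fin.suc (elements p)

  length-elements : ∀ {m} (p : Subset m) → length (elements p) ≡ ∣ p ∣
  length-elements []          = refl
  length-elements (true  ∷ p) =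
    cong suc (trans (length-map Fin.suc (elements p)) (length-elements p))
  length-elements (false ∷ p) = trans (length-map Fin.suc (elements p)) (length-elements p)

  ∈-elements : ∀ {m} {v : Fin m} (p : Subset m) → v Subset.∈ p → v ∈ elements p
  ∈-elements (true  ∷ p) here       = here refl
  ∈-elements (true  ∷ p) (there v∈) = there (∈-map⁺ Fin.suc (∈-elements p v∈))
  ∈-elements (false ∷ p) (there v∈) = ∈-map⁺ Fin.suc (∈-elements p v∈)


module Residues (n : ℕ) .{{_ : NonZero n}} where

  open import Data.Nat as ℕ using (zero; suc; s≤s)
  open import Data.Integer
    using (+_; -[1+_]; -_; _+_; _-_; _*_; _<_; 0ℤ; 1ℤ; -1ℤ; +<+; -<-; _%ℕ_; _/ℕ_)
  open import Data.Integer.Properties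
    using ( +-injective; +-identityˡ; +-identityʳ; +-inverseʳ; *-identityˡ; -1*i≡-i; i-j≡0⇒i≡j
          ; <-≤-trans; i≤j+i; +-monoˡ-<; +-monoʳ-<; neg-mono-<; *-cancelʳ-<-nonNeg)
  open import Data.Integer.DivMod using (a≡a%ℕn+[a/ℕn]*n; n%ℕd<d)
  open import Data.Integer.Tactic.RingSolver using (solve-∀)
  open import Data.Fin using (toℕ)
  open import Data.Fin.Properties using (toℕ-fromℕ<; fromℕ<-cong)
  open import Relation.Binary.PropositionalEquality
    using (_≡_; refl; sym; trans; cong; cong₂; subst; subst₂; module ≡-Reasoning)

  private
    -1<k<1⇒k≡0 : ∀ {k} → -1ℤ < k → k < 1ℤ → k ≡ 0ℤ
    -1<k<1⇒k≡0 {+ zero}    _        _              = refl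
    -1<k<1⇒k≡0 {+ suc _}   _        (+<+ (s≤s ()))
    -1<k<1⇒k≡0 { -[1+ _ ]} (-<- ()) _

    [j+k]-j≡k : ∀ j k → (j + k) - j ≡ k
    [j+k]-j≡k = solve-∀

    -[j-i]≡i-j : ∀ i j → - (j - i) ≡ i - j
    -[j-i]≡i-j = solve-∀

  i<i+n : ∀ i → i < i + + n
  i<i+n i = subst (_< i + + n) (+-identityʳ i) (+-monoʳ-< i (+<+ (ℕ.>-nonZero⁻¹ n)))

  i<j+k⇒i-j<k : ∀ {i j k} → i < j + k → i - j < k
  i<j+k⇒i-j<k {i} {j} {k} i<j+k = subst (i - j <_) ([j+k]-j≡k j k) (+-monoˡ-< (- j) i<j+k)

  i-j≡k*n⇒i≡j : ∀ {i j} k → i - j ≡ k * + n → i < j + + n → j < i + + n → i ≡ j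
  i-j≡k*n⇒i≡j {i} {j} k i-j≡kn i<j+n j<i+n =
    i-j≡0⇒i≡j i j (trans i-j≡kn (cong (_* + n) (-1<k<1⇒k≡0 -1<k k<1)))
    where
    k<1 : k < 1ℤ
    k<1 = *-cancelʳ-<-nonNeg (+ n)
            (subst₂ _<_ i-j≡kn (sym (*-identityˡ (+ n))) (i<j+k⇒i-j<k i<j+n))
    -1<k : -1ℤ < k
    -1<k = *-cancelʳ-<-nonNeg (+ n)
             (subst₂ _<_ (sym (-1*i≡-i (+ n))) (trans (-[j-i]≡i-j i j) i-j≡kn)
               (neg-mono-< (i<j+k⇒i-j<k j<i+n)))

  %ℕ-unique : ∀ a r q → r ℕ.< n → a ≡ + r + q * + n → a %ℕ n ≡ r
  %ℕ-unique a r q r<n a≡r+qn =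
    +-injective (i-j≡k*n⇒i≡j (q - q′) difference (bound (n%ℕd<d a n)) (bound r<n))
    where
    open ≡-Reasoning
    r′ : ℕ
    r′ = a %ℕ n
    q′ : ℤ
    q′ = a /ℕ n
    bound : ∀ {x y} → x ℕ.< n → + x < + y + + n
    bound {x} {y} x<n = <-≤-trans (+<+ x<n) (i≤j+i (+ n) (+ y))
    regroup : ∀ x y u v m → x - y ≡ ((x + u * m) - (y + v * m)) + (v - u) * m
    regroup = solve-∀
    difference : + r′ - + r ≡ (q - q′) * + n
    difference = begin
        + r′ - + r
      ≡⟨ regroup (+ r′) (+ r) q′ q (+ n) ⟩
        ((+ r′ + q′ * + n) - (+ r + q * + n)) + (q - q′) * + n
      ≡⟨ cong₂ (λ u v → (u - v) + (q - q′) * + n) (sym (a≡a%ℕn+[a/ℕn]*n a n)) (sym a≡r+qn) ⟩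
        (a - a) + (q - q′) * + n
      ≡⟨ cong (_+ (q - q′) * + n) (+-inverseʳ a) ⟩
        0ℤ + (q - q′) * + n
      ≡⟨ +-identityˡ _ ⟩
        (q - q′) * + n
      ∎

  scan-+n : ∀ s → scan n (s + + n) ≡ scan n s
  scan-+n s =
    fromℕ<-cong _ _ (%ℕ-unique (s + + n) (s %ℕ n) (s /ℕ n + 1ℤ) (n%ℕd<d s n) s+n≡r+qn) _ _
    where
    shift : ∀ r q m → (r + q * m) + m ≡ r + (q + 1ℤ) * m
    shift = solve-∀
    s+n≡r+qn : s + + n ≡ + (s %ℕ n) + (s /ℕ n + 1ℤ) * + n
    s+n≡r+qn = trans (cong (_+ + n) (a≡a%ℕn+[a/ℕn]*n s n)) (shift (+ (s %ℕ n)) (s /ℕ n) (+ n))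

  scan-injective : ∀ {t u} → scan n t ≡ scan n u → t < u + + n → u < t + + n → t ≡ u
  scan-injective {t} {u} scan≡ = i-j≡k*n⇒i≡j (t /ℕ n - u /ℕ n) difference
    where
    open ≡-Reasoning
    rₜ rᵤ : ℕ
    rₜ = t %ℕ n
    rᵤ = u %ℕ n
    rₜ≡rᵤ : rₜ ≡ rᵤ
    rₜ≡rᵤ = trans (sym (toℕ-fromℕ< (n%ℕd<d t n)))
              (trans (cong toℕ scan≡) (toℕ-fromℕ< (n%ℕd<d u n)))
    cancel : ∀ r x y m → (r + x * m) - (r + y * m) ≡ (x - y) * m
    cancel = solve-∀
    difference : t - u ≡ (t /ℕ n - u /ℕ n) * + n
    difference = begin
        t - u
      ≡⟨ cong₂ _-_ (a≡a%ℕn+[a/ℕn]*n t n) (a≡a%ℕn+[a/ℕn]*n u n) ⟩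
        (+ rₜ + (t /ℕ n) * + n) - (+ rᵤ + (u /ℕ n) * + n)
      ≡⟨ cong (λ r → (+ r + (t /ℕ n) * + n) - (+ rᵤ + (u /ℕ n) * + n)) rₜ≡rᵤ ⟩
        (+ rᵤ + (t /ℕ n) * + n) - (+ rᵤ + (u /ℕ n) * + n)
      ≡⟨ cancel (+ rᵤ) (t /ℕ n) (u /ℕ n) (+ n) ⟩
        (t /ℕ n - u /ℕ n) * + n
      ∎


module WitnessTimes (n : ℕ) .{{_ : NonZero n}} where

  open import Data.Nat as ℕ using (suc)
  open import Data.Integer using (+_; _+_; _≤_; _<_; _≤?_)
  open import Data.Integer.Properties
    using ( ≤-<-trans; <-≤-trans; <-trans; <⇒≤; <⇒≱; ≰⇒>; +-monoˡ-≤; +-monoˡ-<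
          ; +-0-abelianGroup)
  open import Algebra.Bundles using (AbelianGroup)
  open import Algebra.Properties.Group (AbelianGroup.group +-0-abelianGroup) using (∙-cancelʳ)
  open import Data.Bool using (Bool; true; false)
  open import Data.Fin as Fin using (Fin)
  open import Data.Fin.Subset as Subset using (∣_∣)
  open import Data.Vec as Vec using (Vec; []; _∷_; lookup)
  open import Data.List using (List; []; _∷_; length; applyUpTo; cartesianProduct)
  open import Data.List.Properties using (∷-injective; ∷-injectiveˡ; ∷-injectiveʳ)
  open import Data.List.Membership.Propositional using (_∈_)
  open import Data.List.Membership.Propositional.Properties using (∈-cartesianProduct⁺)
  open import Data.List.Relation.Unary.Any using (here; there)
  open import Data.List.Relation.Unary.Linked using (Linked; _∷_)
  open import Data.List.Relation.Binary.Pointwise using (Pointwise; []; _∷_)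
  open import Data.Product using (_×_; _,_; proj₁; proj₂)
  open import Data.Product.Properties using (×-≡,≡→≡; ×-≡,≡←≡)
  open import Relation.Nullary using (yes; no; does; contradiction)
  open import Relation.Nullary.Decidable using (dec-false)
  open import Relation.Binary.PropositionalEquality using (_≡_; refl; sym; trans; cong; cong₂)
  open Residues n
  open Lists using (elements; ∈-elements; length-cartesianProductWith; length-elements)

  time : Vtx n → ℤ
  time = proj₂

  UpdTime-< : ∀ {v t s} → IsUpdTime n v t s → t < s + + n
  UpdTime-< {v} {t} {s} (_ , scan-s≡v , s-latest) with s + + n ≤? t
  ... | yes s+n≤t =
    contradiction (s-latest (s + + n) s+n≤t (trans (scan-+n s) scan-s≡v)) (<⇒≱ (i<i+n s))
  ... | no  s+n≰t = ≰⇒> s+n≰t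

  Edge⇒window : ∀ {a b} → Edge n a b → time b < time a × time a < time b + + n
  Edge⇒window (tb<ta , _ , (_ , _ , s-upd-a) , (_ , _ , s-upd-b)) =
    tb<ta , <-≤-trans (UpdTime-< s-upd-a) (+-monoˡ-≤ (+ n) (proj₁ s-upd-b))

  Near : ℤ → ℤ → Set
  Near r t = t ≤ r × r < (t + + n) + + n

  Edge-Edge⇒Near : ∀ {a b c} → Edge n a b → Edge n b c → Near (time a) (time c)
  Edge-Edge⇒Near ab bc
    with tb<ta , ta<tb+n ← Edge⇒window ab | tc<tb , tb<tc+n ← Edge⇒window bc =
    <⇒≤ (<-trans tc<tb tb<ta) , <-trans ta<tb+n (+-monoˡ-< (+ n) tb<tc+n)

  digit : ℤ → ℤ → Fin n × Bool
  digit r t = scan n t , does (t + + n ≤? r)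

  digit-injective : ∀ {r t u} → Near r t → Near r u → digit r t ≡ digit r u → t ≡ u
  digit-injective {r} {t} {u} (t≤r , r<t+2n) (u≤r , r<u+2n) digit≡
    with t + + n ≤? r | u + + n ≤? r | ×-≡,≡←≡ digit≡
  ... | yes t+n≤r | yes u+n≤r | scan≡ , _ =
    ∙-cancelʳ (+ n) t u
      (scan-injective (trans (scan-+n t) (trans scan≡ (sym (scan-+n u))))
        (≤-<-trans t+n≤r r<u+2n) (≤-<-trans u+n≤r r<t+2n))
  ... | no r≮t+n | no r≮u+n | scan≡ , _ =
    scan-injective scan≡ (≤-<-trans t≤r (≰⇒> r≮u+n)) (≤-<-trans u≤r (≰⇒> r≮t+n))
  ... | yes _ | no _  | _ , ()
  ... | no _  | yes _ | _ , ()

  r<t+n⇒digit≡ : ∀ {r t} → r < t + + n → digit r t ≡ (scan n t , false)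
  r<t+n⇒digit≡ {r} {t} r<t+n = cong (scan n t ,_) (dec-false (t + + n ≤? r) (<⇒≱ r<t+n))

  encode : ℤ → List ℤ → List (Fin n × Bool)
  encode r []       = []
  encode r (t ∷ ts) = digit r t ∷ encode t ts

  encode-injective : ∀ {r ts us} → Linked Near (r ∷ ts) → Linked Near (r ∷ us) →
                     encode r ts ≡ encode r us → ts ≡ us
  encode-injective {ts = []}     {[]}     _ _ _ = refl
  encode-injective {ts = []}     {_ ∷ _}  _ _ ()
  encode-injective {ts = _ ∷ _}  {[]}     _ _ ()
  encode-injective {ts = t ∷ ts} {u ∷ us} (r~t ∷ t~ts) (r~u ∷ u~us) code≡
    with refl ← digit-injective r~t r~u (∷-injectiveˡ code≡) =
    cong (t ∷_) (encode-injective t~ts u~us (∷-injectiveʳ code≡))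

  times : ∀ {m} → Vec (Vtx n) m → List ℤ
  times x = Vec.toList (Vec.map time x)

  ≡-from-labels-times : ∀ {m} (x y : Vec (Vtx n) m) →
                        (∀ j → label n (lookup x j) ≡ label n (lookup y j)) →
                        times x ≡ times y → x ≡ y
  ≡-from-labels-times []      []      _       _      = refl
  ≡-from-labels-times (a ∷ x) (b ∷ y) labels≡ times≡
    with time≡ , times≡′ ← ∷-injective times≡ =
    cong₂ _∷_ (×-≡,≡→≡ (labels≡ Fin.zero , time≡))
      (≡-from-labels-times x y (λ j → labels≡ (Fin.suc j)) times≡′)

  digitsIn : Subset n → List Bool → List (Fin n × Bool)
  digitsIn D bs = cartesianProduct (elements D) bs

  length-digitsIn : ∀ D bs → length (digitsIn D bs) ≡ ∣ D ∣ ℕ.* length bs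
  length-digitsIn D bs =
    trans (length-cartesianProductWith _,_ (elements D) bs)
      (cong (ℕ._* length bs) (length-elements D))

  bothBits : List Bool
  bothBits = false ∷ true ∷ []

  ∈-bothBits : ∀ b → b ∈ bothBits
  ∈-bothBits false = here refl
  ∈-bothBits true  = there (here refl)

  encode∈digitsIn : ∀ {m} r (x : Vec (Vtx n) m) (D : ℕ → Subset n) →
                    (∀ j → scan n (time (lookup x j)) Subset.∈ D (Fin.toℕ j)) →
                    Pointwise _∈_ (encode r (times x))
                                  (applyUpTo (λ j → digitsIn (D j) bothBits) m)
  encode∈digitsIn r []      D scan∈ = []
  encode∈digitsIn r (a ∷ x) D scan∈ =
    ∈-cartesianProduct⁺ (∈-elements (D 0) (scan∈ Fin.zero)) (∈-bothBits _)
      ∷ encode∈digitsIn (time a) x (λ j → D (suc j)) (λ j → scan∈ (Fin.suc j))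


module PathCount (n : ℕ) .{{_ : NonZero n}} (𝒞 : Subset n → Set) (T : ℤ) (C : Subset n)
                 (L′ : ℕ) (𝓛 : ℕ → Subset n) where

  open import Data.Nat as ℕ using (zero; suc; _*_; _^_; ⌊_/2⌋; z≤n; s≤s)
  open import Data.Nat.Properties using (*-suc; <⇒≤)
  open import Data.Nat.ListAction using (product)
  open import Data.Nat.Tactic.RingSolver using (solve-∀)
  open import Data.Integer using (+_; _+_; _-_; _≤_; _<_)
  open import Data.Integer.Properties using (<-trans; <-≤-trans; +-monoˡ-<; +-monoˡ-≤)
  open import Data.Integer.Tactic.RingSolver as ℤ-Ring using ()
  open import Data.Bool using (Bool; false)
  open import Data.Fin as Fin using (Fin; toℕ)
  open import Data.Fin.Properties using (toℕ≤pred[n])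
  open import Data.Fin.Subset as Subset using (∣_∣)
  open import Data.Vec as Vec using (Vec; _∷_; lookup)
  open import Data.Vec.Properties using (lookup-map)
  open import Data.List using (List; [_]; _∷_; length; map; applyUpTo; upTo)
  open import Data.List.Properties using (map-applyUpTo)
  open import Data.List.Membership.Propositional using (_∈_)
  open import Data.List.Membership.Propositional.Properties using (∈-cartesianProduct⁺)
  open import Data.List.Relation.Unary.Any using (here)
  open import Data.List.Relation.Binary.Pointwise using (_∷_)
  open import Data.List.Relation.Unary.Linked using (Linked)
  open import Data.List.Relation.Unary.Linked.Properties using (applyUpTo⁺₁)
  open import Data.Product using (_×_; _,_; proj₁; proj₂)
  open import Relation.Binary.PropositionalEquality
    using (_≡_; refl; sym; trans; cong; cong₂; subst; module ≡-Reasoning)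
  open Lists
  open Residues n using (i<i+n)
  open WitnessTimes n

  i≤⌊m/2⌋⇒2*i≤m : ∀ i m → i ℕ.≤ ⌊ m /2⌋ → 2 * i ℕ.≤ m
  i≤⌊m/2⌋⇒2*i≤m zero    m             _             = z≤n
  i≤⌊m/2⌋⇒2*i≤m (suc i) (suc (suc m)) (s≤s i≤⌊m/2⌋) =
    subst (ℕ._≤ suc (suc m)) (sym (*-suc 2 i)) (s≤s (s≤s (i≤⌊m/2⌋⇒2*i≤m i m i≤⌊m/2⌋)))

  L : ℕ
  L = suc L′

  k : ℕ
  k = ⌊ L′ /2⌋

  2*toℕ<L : (j : Fin (suc k)) → 2 * toℕ j ℕ.< L
  2*toℕ<L j = s≤s (i≤⌊m/2⌋⇒2*i≤m (toℕ j) L′ (toℕ≤pred[n] j))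

  InP⇒start : ∀ {p} → InP n 𝒞 T C L p → time (p 0) ≤ T × T < time (p 0) + + n
  InP⇒start ((inVT , _) , _ , (s , (_ , _ , s≤t , _) , T-n<s , _)) =
    proj₂ (proj₁ (proj₂ (inVT 0 (s≤s z≤n)))) ,
    <-≤-trans (subst (_< s + + n) ([T-n]+n≡T T (+ n)) (+-monoˡ-< (+ n) T-n<s))
              (+-monoˡ-≤ (+ n) s≤t)
    where
    [T-n]+n≡T : ∀ t m → (t - m) + m ≡ t
    [T-n]+n≡T = ℤ-Ring.solve-∀

  InP²⇒Linked : ∀ {x} → InP² n 𝒞 T C L x → Linked Near (T ∷ times x)
  InP²⇒Linked {x} (p , inP@((_ , _ , edges , _) , _) , x≡p) =
    subst (λ ts → Linked Near (T ∷ ts)) (sym times≡) (applyUpTo⁺₁ g (suc (suc k)) near)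
    where
    f : ℕ → ℤ
    f j = time (p (2 * j))
    g : ℕ → ℤ
    g zero    = T
    g (suc j) = f j
    times≡ : times x ≡ applyUpTo f (suc k)
    times≡ = toList≗applyUpTo (Vec.map time x) f
               (λ j → trans (lookup-map j time x) (cong time (x≡p j)))
    near : ∀ {i} → suc i ℕ.< suc (suc k) → Near (g i) (g (suc i))
    near {zero} _ with t≤T , T<t+n ← InP⇒start inP = t≤T , <-trans T<t+n (i<i+n _)
    near {suc j} (s≤s (s≤s j<k)) =
      subst (λ i → Near (f j) (time (p i))) (sym (*-suc 2 j))
        (Edge-Edge⇒Near (edges (2 * j) (<⇒≤ 2j+2<L)) (edges (suc (2 * j)) 2j+2<L))
      where
      2j+2<L : suc (suc (2 * j)) ℕ.< L
      2j+2<L = s≤s (subst (ℕ._≤ L′) (*-suc 2 j) (i≤⌊m/2⌋⇒2*i≤m (suc j) L′ j<k))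

  LabelledInP² : Vec (Vtx n) (suc k) → Set
  LabelledInP² x = InP² n 𝒞 T C L x × (∀ j → label n (lookup x j) ≡ 𝓛 (toℕ j))

  LabelledInP²⇒scan∈ : ∀ {x} → LabelledInP² x →
                       ∀ j → scan n (time (lookup x j)) Subset.∈ 𝓛 (toℕ j)
  LabelledInP²⇒scan∈ {x} ((p , ((inVT , _) , _) , x≡p) , labels) j =
    subst (scan n (time (lookup x j)) Subset.∈_) (labels j)
      (subst (λ v → scan n (time v) Subset.∈ label n v) (sym (x≡p j))
        (proj₂ (proj₂ (inVT (2 * toℕ j) (2*toℕ<L j)))))

  candidates : List (List (Fin n × Bool))
  candidates =
    choices (digitsIn (𝓛 0) [ false ] ∷ applyUpTo (λ j → digitsIn (𝓛 (suc j)) bothBits) k)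

  code : Vec (Vtx n) (suc k) → List (Fin n × Bool)
  code x = encode T (times x)

  code∈candidates : ∀ {x} → LabelledInP² x → code x ∈ candidates
  code∈candidates {a ∷ x} labelled@((p , inP , a≡p) , _) =
    ∈-choices (head∈ ∷ encode∈digitsIn (time a) x (λ j → 𝓛 (suc j)) (λ j → scan∈ (Fin.suc j)))
    where
    scan∈ : ∀ j → scan n (time (lookup (a ∷ x) j)) Subset.∈ 𝓛 (toℕ j)
    scan∈ = LabelledInP²⇒scan∈ {a ∷ x} labelled
    T<t+n : T < time a + + n
    T<t+n = subst (λ v → T < time v + + n) (sym (a≡p Fin.zero)) (proj₂ (InP⇒start {p} inP))
    head∈ : digit T (time a) ∈ digitsIn (𝓛 0) [ false ]
    head∈ = subst (_∈ digitsIn (𝓛 0) [ false ]) (sym (r<t+n⇒digit≡ {T} {time a} T<t+n))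
              (∈-cartesianProduct⁺ (∈-elements (𝓛 0) (scan∈ Fin.zero)) (here refl))

  code-injectiveOn : ∀ {x y} → LabelledInP² x → LabelledInP² y → code x ≡ code y → x ≡ y
  code-injectiveOn {x} {y} (x∈P² , x-labels) (y∈P² , y-labels) code≡ =
    ≡-from-labels-times x y (λ j → trans (x-labels j) (sym (y-labels j)))
      (encode-injective (InP²⇒Linked x∈P²) (InP²⇒Linked y∈P²) code≡)

  length-candidates : length candidates ≡ 2 ^ k * product (map (λ i → ∣ 𝓛 i ∣) (upTo (suc k)))
  length-candidates = begin
      length candidates
    ≡⟨ length-choices (digitsIn (𝓛 0) [ false ] ∷ applyUpTo slot k) ⟩
      length (digitsIn (𝓛 0) [ false ]) * product (map length (applyUpTo slot k))
    ≡⟨ cong₂ _*_ (length-digitsIn (𝓛 0) [ false ])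
         (trans (cong product (map-applyUpTo slot length k))
           (product-applyUpTo-*ʳ _ (λ j → ∣ 𝓛 (suc j) ∣) 2 k
             (λ j → length-digitsIn (𝓛 (suc j)) bothBits))) ⟩
      ∣ 𝓛 0 ∣ * 1 * (2 ^ k * product (applyUpTo (λ j → ∣ 𝓛 (suc j) ∣) k))
    ≡⟨ rearrange ∣ 𝓛 0 ∣ (2 ^ k) _ ⟩
      2 ^ k * (∣ 𝓛 0 ∣ * product (applyUpTo (λ j → ∣ 𝓛 (suc j) ∣) k))
    ≡⟨ cong (λ ns → 2 ^ k * (∣ 𝓛 0 ∣ * product ns)) (map-applyUpTo suc (λ i → ∣ 𝓛 i ∣) k) ⟨
      2 ^ k * product (map (λ i → ∣ 𝓛 i ∣) (upTo (suc k)))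
    ∎
    where
    open ≡-Reasoning
    slot : ℕ → List (Fin n × Bool)
    slot j = digitsIn (𝓛 (suc j)) bothBits
    rearrange : ∀ a b c → a * 1 * (b * c) ≡ b * (a * c)
    rearrange = solve-∀


open import Data.Nat using (suc; _≤_; _<_; _*_; _^_; _∸_; ⌊_/2⌋; z≤n; s≤s)
open import Data.Nat.Properties using (module ≤-Reasoning)
open import Data.Nat.ListAction using (product)
open import Data.Integer using (+_)
open import Data.Fin using (toℕ)
open import Data.Fin.Subset using (Nonempty; ∣_∣)
open import Data.Vec using (Vec; lookup)
open import Data.List using (List; length; map; upTo)
open import Data.List.Properties using (length-map)
open import Data.List.Relation.Unary.All as All using (All)
import Data.List.Relation.Unary.All.Properties as Allₚ
open import Data.List.Membership.Propositional using (_∈_)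
open import Data.List.Relation.Unary.Unique.Propositional using (Unique)
open import Data.Product using (_×_)
open import Relation.Binary.PropositionalEquality using (_≡_)
open Lists using (Unique⇒length≤; Unique-map⁺-injectiveOn)

lemma4p4 : (n : ℕ) .{{_ : NonZero n}} (𝒞 : Subset n → Set)
    → (∀ D → 𝒞 D → Nonempty D)
    → (L : ℕ) → 1 ≤ L
    → (C : Subset n) → 𝒞 C
    → (𝓛 : ℕ → Subset n) → 𝓛 0 ≡ C
    → (∀ i → suc i < ⌊ suc L /2⌋ → Γ⁺² 𝒞 (𝓛 i) (𝓛 (suc i)))
    → (xs : List (Vec (Vtx n) ⌊ suc L /2⌋))
    → Unique xs
    → All (λ x → InP² n 𝒞 (+ (n * suc L)) C L x
                 × (∀ j → label n (lookup x j) ≡ 𝓛 (toℕ j))) xs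
    → length xs ≤ 2 ^ (⌊ suc L /2⌋ ∸ 1) * product (map (λ i → ∣ 𝓛 i ∣) (upTo ⌊ suc L /2⌋))
lemma4p4 n 𝒞 _ (suc L′) (s≤s z≤n) C _ 𝓛 _ _ xs xs-unique xs-labelled = begin
    length xs             ≡⟨ length-map code xs ⟨
    length (map code xs)  ≤⟨ Unique⇒length≤ codes-unique codes∈candidates ⟩
    length candidates     ≡⟨ length-candidates ⟩
    2 ^ k * product (map (λ i → ∣ 𝓛 i ∣) (upTo (suc k)))
  ∎
  where
  open ≤-Reasoning
  open PathCount n 𝒞 (+ (n * suc (suc L′))) C L′ 𝓛
  codes-unique : Unique (map code xs)
  codes-unique = Unique-map⁺-injectiveOn code-injectiveOn xs-labelled xs-unique
  codes∈candidates : All (_∈ candidates) (map code xs)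
  codes∈candidates = Allₚ.map⁺ (All.map code∈candidates xs-labelled)
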